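{- Let $P$ be a finite bounded poset with $|P|>1$, $\omega$ an admissible map on $P$, and $r$ a rational with $0\le r<1$. If $A$ is a nontrivial antichain in $P$ and $\mathfrak{y}_r(A)\neq\emptyset$ (w.r.t. $\omega$), then $$A\subseteq\mathbf{I}_{r'}\bigl(P,\mathfrak{y}_r(A);\omega\bigr),\qquad\text{where } r':=r\cdot\frac{\min_{p\in\mathfrak{y}_r(A)}\omega(p)}{\max_{p\in A}\omega(p)}.$$
   Context: $P$ is a finite poset with least element $\hat0_P$ and greatest element $\hat1_P$, $|P|>1$. For $A\subseteq P$, $\mathfrak I(A)=\{p: p\le a\text{ for some }a\in A\}$; $\min Q$, $\max Q$ denote minimal/maximal elements of $Q\subseteq P$. $\mathfrak{A}_{\vartriangle}(P)$: all antichains (including empty) ordered by $\mathfrak I(A')\subseteq\mathfrak I(A'')$, with meet $A'\wedge_{\vartriangle}A''=\max(\mathfrak I(A')\cap\mathfrak I(A''))$. The trivial antichains are $\emptyset$ and $\{\hat0_P\}$; others are nontrivial. Admissible map: $\omega:\mathfrak{A}_{\vartriangle}(P)\to\{ -1\}\cup\mathbb N$ with $\omega(\emptyset)=-1$, $\omega(\{\hat0_P\})=0$, $0<\omega(A')\le\omega(A'')$ whenever $\{\hat0_P\}<A'\le A''$ in $\mathfrak{A}_{\vartriangle}(P)$; $\omega(b):=\omega(\{b\})$. For a rational $s\ge0$ and a subset $B\subseteq P$ that is nonempty and $\ne\{\hat0_P\}$, an element $b\in P\setminus\{\hat0_P\}$ is relatively $s$-blocking for $B$ if $\omega(\{b\}\wedge_{\vartriangle}\{c\})/\omega(b)>s$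 for all $c\in B\setminus\{\hat0_P\}$; $\mathbf{I}_s(P,B;\omega)$ is the set of such elements. For a nontrivial antichain $A$, the relative $r$-blocker is $\mathfrak{y}_r(A)=\min\mathbf{I}_r(P,A;\omega)$. -}

module Defs where

open import Data.Nat as ℕ using (ℕ; zero; suc)
open import Data.Integer as ℤ using (ℤ; +_; -[1+_])
open import Data.Rational as ℚ using (ℚ)
open import Data.Rational.Properties as ℚP using ()
open import Data.Fin using (Fin)
open import Data.Fin.Properties using (any?; all?) renaming (_≟_ to _≟ᶠ_)
open import Data.Fin.Subset using (Subset; _∈_; _⊆_; _∩_; ⁅_⁆; ⊥; Nonempty)
open import Data.Fin.Subset.Properties using (_∈?_)
open import Data.Vec using (tabulate)
open import Data.List using (List; []; _∷_; foldr; map; filter)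
open import Data.List.Base using (allFin)
open import Data.Product using (_×_; _,_; ∃)
open import Relation.Nullary using (¬_; Dec; ¬?; _×-dec_; _→-dec_)
open import Relation.Nullary.Decidable using (⌊_⌋)
open import Relation.Binary using (IsPartialOrder)
open import Relation.Binary.PropositionalEquality using (_≡_; _≢_)

record FinBoundedPoset : Set₁ where
  field
    size        : ℕ
    _≤_         : Fin size → Fin size → Set
    _≤?_        : ∀ p q → Dec (p ≤ q)
    isPartialOrder : IsPartialOrder _≡_ _≤_
    bot top     : Fin size
    bot-least   : ∀ p → bot ≤ p
    top-greatest : ∀ p → p ≤ top
    size>1      : 1 ℕ.< size

-- a / b as a rational, for b a positive integer (default 0 otherwise;
-- only ever used with positive denominators)
frac : ℤ → ℤ → ℚ
frac a (+ suc k) = a ℚ./ suc k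
frac a _         = ℚ.0ℚ

-- maximum / minimum of a finite list of integers (default 0 on empty list;
-- only used on nonempty lists)
maxL : List ℤ → ℤ
maxL []       = + 0
maxL (x ∷ xs) = foldr ℤ._⊔_ x xs

minL : List ℤ → ℤ
minL []       = + 0
minL (x ∷ xs) = foldr ℤ._⊓_ x xs

module Theory (P : FinBoundedPoset) where
  open FinBoundedPoset P

  Elt : Set
  Elt = Fin size

  _<_ : Elt → Elt → Set
  p < q = p ≤ q × p ≢ q

  _<?_ : ∀ p q → Dec (p < q)
  p <? q = (p ≤? q) ×-dec ¬? (p ≟ᶠ q)

  ideal : Subset size → Subset size
  ideal A = tabulate λ p → ⌊ any? (λ q → (q ∈? A) ×-dec (p ≤? q)) ⌋

  maxOf : Subset size → Subset size
  maxOf Q = tabulate λ p → ⌊ (p ∈? Q) ×-dec ¬? (any? (λ q → (q ∈? Q) ×-dec (p <? q))) ⌋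

  minOf : Subset size → Subset size
  minOf Q = tabulate λ p → ⌊ (p ∈? Q) ×-dec ¬? (any? (λ q → (q ∈? Q) ×-dec (q <? p))) ⌋

  IsAntichain : Subset size → Set
  IsAntichain A = ∀ p q → p ∈ A → q ∈ A → p ≤ q → p ≡ q

  _≤A_ : Subset size → Subset size → Set
  A ≤A B = ideal A ⊆ ideal B

  _∧A_ : Subset size → Subset size → Subset size
  A ∧A B = maxOf (ideal A ∩ ideal B)

  Nontrivial : Subset size → Set
  Nontrivial A = IsAntichain A × A ≢ ⊥ × A ≢ ⁅ bot ⁆

  -- admissible maps (ω given on all subsets, constrained on antichains;
  -- values of the form {-1} ∪ ℕ are forced by the conditions)
  record Admissible (ω : Subset size → ℤ) : Set where
    field
      ω-empty : ω ⊥ ≡ -[1+ 0 ]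
      ω-bot   : ω ⁅ bot ⁆ ≡ + 0
      ω-mono  : ∀ A B → IsAntichain A → IsAntichain B →
                ⁅ bot ⁆ ≤A A → A ≢ ⁅ bot ⁆ → A ≤A B →
                (+ 0 ℤ.< ω A) × (ω A ℤ.≤ ω B)

  ωe : (Subset size → ℤ) → Elt → ℤ
  ωe ω b = ω ⁅ b ⁆

  RelBlocking : (Subset size → ℤ) → ℚ → Subset size → Elt → Set
  RelBlocking ω s B b =
    b ≢ bot × (∀ c → c ∈ B → c ≢ bot → s ℚ.< frac (ω (⁅ b ⁆ ∧A ⁅ c ⁆)) (ωe ω b))

  relBlocking? : ∀ ω s B b → Dec (RelBlocking ω s B b)
  relBlocking? ω s B b =
    ¬? (b ≟ᶠ bot) ×-dec
    all? (λ c → (c ∈? B) →-dec ((¬? (c ≟ᶠ bot)) →-dec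
                  (s ℚP.<? frac (ω (⁅ b ⁆ ∧A ⁅ c ⁆)) (ωe ω b))))

  𝐈 : (Subset size → ℤ) → ℚ → Subset size → Subset size
  𝐈 ω s B = tabulate λ b → ⌊ relBlocking? ω s B b ⌋

  𝔶 : (Subset size → ℤ) → ℚ → Subset size → Subset size
  𝔶 ω r A = minOf (𝐈 ω r A)

  elems : Subset size → List Elt
  elems S = filter (_∈? S) (allFin size)

  maxω minω : (Subset size → ℤ) → Subset size → ℤ
  maxω ω S = maxL (map (ωe ω) (elems S))
  minω ω S = minL (map (ωe ω) (elems S))

-- For a ∈ A and c ∈ 𝔶_r(A) ⊆ 𝐈_r(P, A; ω) blocking gives r < ω(c ∧ a)/ω(c), so
--   r · min_𝔶 ω / max_A ω  ≤  r · ω(c)/ω(a)  <  ω(c ∧ a)/ω(c) · ω(c)/ω(a)  =  ω(a ∧ c)/ω(a),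
-- using only r ≥ 0 and ω > 0 off 0̂.
module Submission where

open import Defs
open import Data.Bool.Properties using (T-≡)
open import Data.Fin.Base using (Fin)
open import Data.Fin.Subset using (Subset; _∈_; _∉_; _⊆_; ⁅_⁆; ⊥)
open import Data.Fin.Subset.Properties using (x∈⁅x⁆; x∈⁅y⁆⇒x≡y; ⊆-antisym; ∩-comm; _∈?_)
open import Data.Integer.Base as ℤ using (ℤ; +_; +[1+_])
import Data.Integer.Properties as ℤ
open import Data.List.Base using (_∷_)
open import Data.List.Membership.Propositional as List using ()
open import Data.List.Membership.Propositional.Properties using (∈-filter⁺; ∈-allFin; ∈-map⁺)
open import Data.List.Properties using (foldr-preservesᵒ)
import Data.List.Relation.Unary.Any as Any
open import Data.Nat.Base as ℕ using (suc; s≤s)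
open import Data.Product using (_,_; proj₁; proj₂)
open import Data.Rational.Base as ℚ using (ℚ; 0ℚ; 1ℚ; _/_; toℚᵘ; fromℚᵘ)
open import Data.Rational.Properties as ℚ
  using (toℚᵘ-fromℚᵘ; toℚᵘ-injective; toℚᵘ-cancel-≤; toℚᵘ-homo-*; normalize-pos
        ; *-monoˡ-≤-nonNeg; *-monoˡ-<-pos)
open import Data.Rational.Unnormalised.Base as ℚᵘ using (mkℚᵘ; *≤*; *≡*)
import Data.Rational.Unnormalised.Properties as ℚᵘ
open import Data.Sum.Base using ([_,_])
open import Data.Vec.Base using (tabulate)
open import Data.Vec.Properties using (lookup∘tabulate; []=⇒lookup; lookup⇒[]=)
open import Function.Bundles using (Equivalence)
open import Relation.Binary.Structures using (IsPartialOrder)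
open import Relation.Binary.PropositionalEquality
  using (_≡_; _≢_; refl; sym; trans; cong; subst)
open import Relation.Nullary.Decidable using (⌊_⌋; toWitness; fromWitness)
open import Relation.Unary using (Pred; Decidable)

∈-tabulate-dec⁻ : ∀ {n p} {Q : Pred (Fin n) p} (Q? : Decidable Q) {x} →
                  x ∈ tabulate (λ y → ⌊ Q? y ⌋) → Q x
∈-tabulate-dec⁻ Q? {x} x∈ = toWitness {a? = Q? x}
  (Equivalence.from T-≡ (trans (sym (lookup∘tabulate _ x)) ([]=⇒lookup x∈)))

∈-tabulate-dec⁺ : ∀ {n p} {Q : Pred (Fin n) p} (Q? : Decidable Q) {x} →
                  Q x → x ∈ tabulate (λ y → ⌊ Q? y ⌋)
∈-tabulate-dec⁺ Q? {x} qx = lookup⇒[]= x _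
  (trans (lookup∘tabulate _ x) (Equivalence.to T-≡ (fromWitness {a? = Q? x} qx)))

minL-≤ : ∀ {xs y} → y List.∈ xs → minL xs ℤ.≤ y
minL-≤ {x ∷ xs} y∈ = foldr-preservesᵒ (λ i j → [ ℤ.i≤j⇒i⊓k≤j j , ℤ.i≤j⇒k⊓i≤j i ])
                                      x xs (Any.toSum (List.lose y∈ ℤ.≤-refl))

≤-maxL : ∀ {xs y} → y List.∈ xs → y ℤ.≤ maxL xs
≤-maxL {x ∷ xs} y∈ = foldr-preservesᵒ (λ i j → [ ℤ.i≤j⇒i≤j⊔k j , ℤ.i≤j⇒i≤k⊔j i ])
                                      x xs (Any.toSum (List.lose y∈ ℤ.≤-refl))

fromℚᵘ-mono-≤ : ∀ {p q} → p ℚᵘ.≤ q → fromℚᵘ p ℚ.≤ fromℚᵘ q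
fromℚᵘ-mono-≤ {p} {q} p≤q = toℚᵘ-cancel-≤
  (ℚᵘ.≤-respˡ-≃ (ℚᵘ.≃-sym (toℚᵘ-fromℚᵘ p)) (ℚᵘ.≤-respʳ-≃ (ℚᵘ.≃-sym (toℚᵘ-fromℚᵘ q)) p≤q))

/-mono-≤ : ∀ {m n a b} .{{_ : ℤ.NonNegative n}} →
           m ℤ.≤ n → a ℕ.≤ b → m / suc b ℚ.≤ n / suc a
/-mono-≤ {m} {n} {a} {b} m≤n a≤b = fromℚᵘ-mono-≤ {mkℚᵘ m b} {mkℚᵘ n a} (*≤* (begin
  m ℤ.* + suc a  ≤⟨ ℤ.*-monoʳ-≤-nonNeg (+ suc a) m≤n ⟩
  n ℤ.* + suc a  ≤⟨ ℤ.*-monoˡ-≤-nonNeg n (ℤ.+≤+ (s≤s a≤b)) ⟩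
  n ℤ.* + suc b  ∎))
  where open ℤ.≤-Reasoning

/-*-/-cancel : ∀ x c a → (x / suc c) ℚ.* (+ suc c / suc a) ≡ x / suc a
/-*-/-cancel x c a = toℚᵘ-injective (begin-equality
  toℚᵘ ((x / suc c) ℚ.* (+ suc c / suc a))      ≃⟨ toℚᵘ-homo-* (x / suc c) (+ suc c / suc a) ⟩
  toℚᵘ (x / suc c) ℚᵘ.* toℚᵘ (+ suc c / suc a)  ≃⟨ ℚᵘ.*-cong (toℚᵘ-fromℚᵘ (mkℚᵘ x c))
                                                              (toℚᵘ-fromℚᵘ (mkℚᵘ (+ suc c) a)) ⟩
  mkℚᵘ x c ℚᵘ.* mkℚᵘ (+ suc c) a                ≃⟨ *≡* cross ⟩
  mkℚᵘ x a                                      ≃⟨ toℚᵘ-fromℚᵘ (mkℚᵘ x a) ⟨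
  toℚᵘ (x / suc a)                              ∎)
  where
  open ℚᵘ.≤-Reasoning
  cross : (x ℤ.* + suc c) ℤ.* + suc a ≡ x ℤ.* + (suc c ℕ.* suc a)
  cross = trans (ℤ.*-assoc x (+ suc c) (+ suc a))
                (cong (x ℤ.*_) (sym (ℤ.pos-* (suc c) (suc a))))

*-/-< : ∀ {r x m c a b} → 0ℚ ℚ.≤ r → r ℚ.< x / suc c → m ℤ.≤ + suc c → a ℕ.≤ b →
        r ℚ.* (m / suc b) ℚ.< x / suc a
*-/-< {r} {x} {m} {c} {a} {b} r≥0 r<x/c m≤c a≤b = begin-strict
  r ℚ.* (m / suc b)                  ≤⟨ *-monoˡ-≤-nonNeg r {{ℚ.nonNegative r≥0}}
                                          (/-mono-≤ m≤c a≤b) ⟩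
  r ℚ.* (+ suc c / suc a)            <⟨ *-monoˡ-<-pos (+ suc c / suc a)
                                          {{normalize-pos (suc c) (suc a)}} r<x/c ⟩
  (x / suc c) ℚ.* (+ suc c / suc a)  ≡⟨ /-*-/-cancel x c a ⟩
  x / suc a                          ∎
  where open ℚ.≤-Reasoning

*-frac-< : ∀ {r x m c a M} → 0ℚ ℚ.≤ r → + 0 ℤ.< c → + 0 ℤ.< a → a ℤ.≤ M → m ℤ.≤ c →
           r ℚ.< frac x c → r ℚ.* frac m M ℚ.< frac x a
*-frac-< {x = x} {c = +[1+ _ ]} {+[1+ _ ]} {+[1+ _ ]} r≥0 _ _ (ℤ.+≤+ (s≤s a≤M)) m≤c r<x/c =
  *-/-< {x = x} r≥0 r<x/c m≤c a≤M
*-frac-< {c = + 0} _ (ℤ.+<+ ()) _ _ _ _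
*-frac-< _ _ (ℤ.+<+ ()) (ℤ.+≤+ ℕ.z≤n) _ _

module _ (P : FinBoundedPoset) where
  open FinBoundedPoset P
  open IsPartialOrder isPartialOrder using () renaming (trans to ≤-trans)
  open Theory P

  ∈𝐈⁻ : ∀ {ω s B b} → b ∈ 𝐈 ω s B → RelBlocking ω s B b
  ∈𝐈⁻ {ω} {s} {B} = ∈-tabulate-dec⁻ (relBlocking? ω s B)

  ∈𝐈⁺ : ∀ {ω s B b} → RelBlocking ω s B b → b ∈ 𝐈 ω s B
  ∈𝐈⁺ {ω} {s} {B} = ∈-tabulate-dec⁺ (relBlocking? ω s B)

  minOf-⊆ : ∀ {Q} → minOf Q ⊆ Q
  minOf-⊆ p∈ = proj₁ (∈-tabulate-dec⁻ _ p∈)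

  𝔶⊆𝐈 : ∀ {ω r A} → 𝔶 ω r A ⊆ 𝐈 ω r A
  𝔶⊆𝐈 = minOf-⊆

  ⁅⁆-mono-≤A : ∀ {p q} → p ≤ q → ⁅ p ⁆ ≤A ⁅ q ⁆
  ⁅⁆-mono-≤A {p} {q} p≤q x∈ with ∈-tabulate-dec⁻ _ x∈
  ... | y , y∈⁅p⁆ , x≤y = ∈-tabulate-dec⁺ _
    (q , x∈⁅x⁆ q , ≤-trans x≤y (subst (_≤ q) (sym (x∈⁅y⁆⇒x≡y p y∈⁅p⁆)) p≤q))

  ⁅⁆-antichain : ∀ b → IsAntichain ⁅ b ⁆
  ⁅⁆-antichain b p q p∈ q∈ _ = trans (x∈⁅y⁆⇒x≡y b p∈) (sym (x∈⁅y⁆⇒x≡y b q∈))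

  ωe-pos : ∀ {ω} → Admissible ω → ∀ {b} → b ≢ bot → + 0 ℤ.< ωe ω b
  ωe-pos adm {b} b≢bot = proj₁ (Admissible.ω-mono adm ⁅ b ⁆ ⁅ b ⁆
    (⁅⁆-antichain b) (⁅⁆-antichain b) (⁅⁆-mono-≤A (bot-least b)) ⁅b⁆≢⁅bot⁆ (λ x∈ → x∈))
    where
    ⁅b⁆≢⁅bot⁆ : ⁅ b ⁆ ≢ ⁅ bot ⁆
    ⁅b⁆≢⁅bot⁆ eq = b≢bot (x∈⁅y⁆⇒x≡y bot (subst (b ∈_) eq (x∈⁅x⁆ b)))

  ∧A-comm : ∀ A B → A ∧A B ≡ B ∧A A
  ∧A-comm A B = cong maxOf (∩-comm (ideal A) (ideal B))

  nontrivial⇒bot∉ : ∀ {A} → Nontrivial A → bot ∉ A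
  nontrivial⇒bot∉ {A} (antichain , _ , A≢⁅bot⁆) bot∈A = A≢⁅bot⁆ (⊆-antisym A⊆⁅bot⁆ ⁅bot⁆⊆A)
    where
    A⊆⁅bot⁆ : A ⊆ ⁅ bot ⁆
    A⊆⁅bot⁆ {x} x∈A = subst (_∈ ⁅ bot ⁆) (antichain bot x bot∈A x∈A (bot-least x)) (x∈⁅x⁆ bot)
    ⁅bot⁆⊆A : ⁅ bot ⁆ ⊆ A
    ⁅bot⁆⊆A {x} x∈ = subst (_∈ A) (sym (x∈⁅y⁆⇒x≡y bot x∈)) bot∈A

  𝔶-blocks : ∀ {ω r A a c} → c ∈ 𝔶 ω r A → a ∈ A → a ≢ bot →
             r ℚ.< frac (ω (⁅ a ⁆ ∧A ⁅ c ⁆)) (ωe ω c)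
  𝔶-blocks {ω} {r} {A} {a} {c} c∈𝔶 a∈A a≢bot =
    subst (λ m → r ℚ.< frac (ω m) (ωe ω c)) (∧A-comm ⁅ c ⁆ ⁅ a ⁆)
      (proj₂ (∈𝐈⁻ {ω} {r} {A} (𝔶⊆𝐈 {ω} {r} {A} c∈𝔶)) a a∈A a≢bot)

  ∈-elems : ∀ {S c} → c ∈ S → c List.∈ elems S
  ∈-elems {S} {c} c∈S = ∈-filter⁺ (_∈? S) (∈-allFin c) c∈S

  minω-≤ : ∀ {ω S c} → c ∈ S → minω ω S ℤ.≤ ωe ω c
  minω-≤ {ω} c∈S = minL-≤ (∈-map⁺ (ωe ω) (∈-elems c∈S))

  ≤-maxω : ∀ {ω S c} → c ∈ S → ωe ω c ℤ.≤ maxω ω S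
  ≤-maxω {ω} c∈S = ≤-maxL (∈-map⁺ (ωe ω) (∈-elems c∈S))

open FinBoundedPoset using (size)
open Theory

proposition2p6 :
    (P : FinBoundedPoset) →
    (ω : Subset (size P) → ℤ) → Admissible P ω →
    (r : ℚ) → 0ℚ ℚ.≤ r → r ℚ.< 1ℚ →
    (A : Subset (size P)) → Nontrivial P A →
    𝔶 P ω r A ≢ ⊥ →
    A ⊆ 𝐈 P ω (r ℚ.* frac (minω P ω (𝔶 P ω r A)) (maxω P ω A)) (𝔶 P ω r A)
-- The implicit arguments ω, r, A are spelled out: they are not determined by unification
-- against the unfolded definitions, and the attempt is very costly.
proposition2p6 P ω adm r r≥0 _ A nontrivial _ {a} a∈A = ∈𝐈⁺ P {ω} (a≢bot , λ c c∈𝔶 c≢bot →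
  *-frac-< r≥0 (ωe-pos P adm c≢bot) (ωe-pos P adm a≢bot) (≤-maxω P {ω} a∈A) (minω-≤ P {ω} c∈𝔶)
    (𝔶-blocks P {ω} {r} {A} c∈𝔶 a∈A a≢bot))
  where
  a≢bot : a ≢ FinBoundedPoset.bot P
  a≢bot refl = nontrivial⇒bot∉ P nontrivial a∈A
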